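{- Let $H$ be a hypergraph, $(Red,X,Blue)$ a partition of $V(H)$ such that no edge contains both a red and a blue vertex, and $F$ a reduced elimination forest of $H$. Let $P$ be a directed (root-to-leaf direction) path of $F$ whose final vertex is not a leaf, and let $W$ be a non-empty subset of the children of the final vertex of $P$. Suppose that $\mathrm{Cont}_F(P,W)\subseteq Red\cup Blue$ and that $V(P)$ is monochromatic. Then $\mathrm{Cont}_F(P,W)$ is monochromatic.
   Context: A hypergraph $H$ has finite vertex set and edges that are non-empty subsets; two vertices are adjacent if some edge contains both. An elimination forest $F$ of $H$ is a rooted forest on $V(H)$ in which any two vertices of a common edge are in ancestor–descendant relation; $F_u$ is the set of descendants of $u$ (including $u$). $F$ is reduced if every non-leaf $u$ is adjacent in $H$ to some vertex of $F_v$ for each child $v$ of $u$. A set $U\subseteq Red\cup Blue$ is monochromatic if $U\subseteq Red$ or $U\subseteq Blue$. $\mathrm{Cont}_F(P,W)$ is the set obtained from $V(P)$ by adding $F_u$ for every $u$ that is either a child of a non-final vertex of $P$ other than its successor on $P$, or a child of the final vertex of $P$ not belonging to $W$ (this is the context factor with spine $P$ and appendices $W$). -}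

module Defs where

open import Data.Nat using (ℕ; suc)
open import Data.Fin using (Fin; inject₁; fromℕ) renaming (suc to fsuc)
open import Data.List using (List; [])
open import Data.List.Membership.Propositional using (_∈_)
open import Data.List.Relation.Unary.All using (All)
open import Data.Maybe using (Maybe; just)
open import Data.Product using (Σ; ∃; _×_; ∃-syntax)
open import Data.Sum using (_⊎_)
open import Relation.Binary.PropositionalEquality using (_≡_; _≢_)
open import Relation.Nullary using (¬_)

-- A hypergraph on the vertex set Fin n: a list of edges, each a non-empty
-- list of vertices (read as the set of its elements).
record Hypergraph (n : ℕ) : Set where
  field
    edges    : List (List (Fin n))
    nonEmpty : All (λ e → e ≢ []) edges
open Hypergraph public

Adjacent : ∀ {n} → Hypergraph n → Fin n → Fin n → Set
Adjacent H u v = ∃[ e ] (e ∈ edges H × u ∈ e × v ∈ e)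

-- Rooted forests on Fin n, given by a parent map (nothing = root).
Parent : ℕ → Set
Parent n = Fin n → Maybe (Fin n)

-- u ≼ v : u is an ancestor of v or u = v  (i.e. v ∈ F_u).
data Anc {n} (par : Parent n) (u : Fin n) : Fin n → Set where
  here  : Anc par u u
  there : ∀ {v w} → par v ≡ just w → Anc par u w → Anc par u v

IsForest : ∀ {n} → Parent n → Set
IsForest {n} par = ∀ (v w : Fin n) → par v ≡ just w → ¬ Anc par v w

Desc : ∀ {n} → Parent n → Fin n → Fin n → Set
Desc par u v = Anc par u v

IsElimForest : ∀ {n} → Hypergraph n → Parent n → Set
IsElimForest {n} H par =
  IsForest par ×
  (∀ (e : List (Fin n)) → e ∈ edges H → ∀ u v → u ∈ e → v ∈ e →
     Anc par u v ⊎ Anc par v u)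

IsReduced : ∀ {n} → Hypergraph n → Parent n → Set
IsReduced {n} H par =
  ∀ (u v : Fin n) → par v ≡ just u → ∃[ w ] (Desc par v w × Adjacent H u w)

data Colour : Set where
  red x blue : Colour

RedBlue : ∀ {n} → (Fin n → Colour) → Fin n → Set
RedBlue col v = col v ≡ red ⊎ col v ≡ blue

NoRedBlueEdge : ∀ {n} → Hypergraph n → (Fin n → Colour) → Set
NoRedBlueEdge {n} H col = ∀ (e : List (Fin n)) → e ∈ edges H →
  ¬ (∃[ u ] ∃[ v ] (u ∈ e × v ∈ e × col u ≡ red × col v ≡ blue))

-- Subsets of V(H) as predicates.
_⊆_ : ∀ {n} → (Fin n → Set) → (Fin n → Set) → Set
_⊆_ {n} A B = ∀ (v : Fin n) → A v → B v

Monochromatic : ∀ {n} → (Fin n → Colour) → (Fin n → Set) → Set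
Monochromatic col U = (U ⊆ λ v → col v ≡ red) ⊎ (U ⊆ λ v → col v ≡ blue)

-- A directed (root-to-leaf) path of F with k+1 vertices P 0, …, P k:
-- P (i+1) is a child of P i.
IsDirPath : ∀ {n} → Parent n → (k : ℕ) → (Fin (suc k) → Fin n) → Set
IsDirPath par k P = ∀ (i : Fin k) → par (P (fsuc i)) ≡ just (P (inject₁ i))

finalV : ∀ {n} (k : ℕ) → (Fin (suc k) → Fin n) → Fin n
finalV k P = P (fromℕ k)

PathSet : ∀ {n} (k : ℕ) → (Fin (suc k) → Fin n) → Fin n → Set
PathSet k P v = ∃[ i ] (P i ≡ v)

Cont : ∀ {n} → Parent n → (k : ℕ) → (Fin (suc k) → Fin n) →
       (Fin n → Set) → Fin n → Set
Cont par k P W v =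
  PathSet k P v ⊎
  ∃[ u ] (Desc par u v ×
    ((∃[ i ] (par u ≡ just (P (inject₁ i)) × u ≢ P (fsuc i)))
     ⊎ (par u ≡ just (finalV k P) × ¬ W u)))

-- Proof idea: in a reduced elimination forest each child c of u is adjacent to u
-- through some vertex of F_c, and adjacent red/blue vertices share a colour.  By
-- well-founded induction down the forest, every subtree F_u lying inside Red ∪ Blue
-- therefore has the colour of u.  Every vertex of Cont_F(P, W) is on P or in a
-- subtree F_u whose root u is a child of a vertex of P, so it gets the colour of P.
module Submission where

open import Defs
open import Data.Nat using (ℕ; suc)
open import Data.Fin using (Fin)
open import Data.Fin.Induction using (spo-wellFounded)
open import Data.Maybe using (just)
open import Data.Product using (_×_; _,_; ∃-syntax)
open import Data.Sum using (_⊎_; inj₁; inj₂)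
import Data.Sum as Sum
open import Data.Empty using (⊥-elim)
open import Induction.WellFounded using (WellFounded; Acc; acc)
open import Relation.Binary.Structures using (IsStrictPartialOrder)
open import Relation.Binary.PropositionalEquality
  using (_≡_; refl; sym; trans; isEquivalence)

module _ {n : ℕ} (par : Parent n) where

  desc-trans : ∀ {u v w} → Desc par u v → Desc par v w → Desc par u w
  desc-trans u≼v here           = u≼v
  desc-trans u≼v (there pw v≼x) = there pw (desc-trans u≼v v≼x)

  desc-child : ∀ {u c} → par c ≡ just u → Desc par u c
  desc-child pc = there pc here

  desc-root-or-child : ∀ {u z} → Desc par u z →
    z ≡ u ⊎ ∃[ c ] (par c ≡ just u × Desc par c z)
  desc-root-or-child here = inj₁ refl
  desc-root-or-child (there {z} pz u≼w) with desc-root-or-child u≼w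
  ... | inj₁ refl           = inj₂ (z , pz , here)
  ... | inj₂ (c , pc , c≼w) = inj₂ (c , pc , there pz c≼w)

  _⊏_ : Fin n → Fin n → Set
  c ⊏ u = ∃[ w ] (par c ≡ just w × Desc par u w)

  ⊏-trans : ∀ {a b c} → a ⊏ b → b ⊏ c → a ⊏ c
  ⊏-trans (w , pa , b≼w) (v , pb , c≼v) = w , pa , desc-trans (there pb c≼v) b≼w

  ⊏-isStrictPartialOrder : IsForest par → IsStrictPartialOrder _≡_ _⊏_
  ⊏-isStrictPartialOrder forest = record
    { isEquivalence = isEquivalence
    ; irrefl        = λ { refl (w , pc , c≼w) → forest _ w pc c≼w }
    ; trans         = ⊏-trans
    ; <-resp-≈      = (λ { refl a⊏b → a⊏b }) , (λ { refl a⊏b → a⊏b })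
    }

  ⊏-wellFounded : IsForest par → WellFounded _⊏_
  ⊏-wellFounded forest = spo-wellFounded (⊏-isStrictPartialOrder forest)

module _ {n} (H : Hypergraph n) (col : Fin n → Colour) (noRB : NoRedBlueEdge H col) where

  adjacent-colour : ∀ {a b} → RedBlue col a → RedBlue col b → Adjacent H a b → col a ≡ col b
  adjacent-colour (inj₁ ra) (inj₁ rb) _ = trans ra (sym rb)
  adjacent-colour (inj₂ ba) (inj₂ bb) _ = trans ba (sym bb)
  adjacent-colour (inj₁ ra) (inj₂ bb) (e , e∈ , a∈ , b∈) = ⊥-elim (noRB e e∈ (_ , _ , a∈ , b∈ , ra , bb))
  adjacent-colour (inj₂ ba) (inj₁ rb) (e , e∈ , a∈ , b∈) = ⊥-elim (noRB e e∈ (_ , _ , b∈ , a∈ , rb , ba))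

  module _ {par : Parent n} (reduced : IsReduced H par) where

    child-colour : ∀ {u c} → par c ≡ just u →
      RedBlue col u → Desc par c ⊆ RedBlue col → Desc par c ⊆ (λ z → col z ≡ col c) →
      col c ≡ col u
    child-colour {u} {c} pc rb-u rb-Fc mono-Fc with reduced u c pc
    ... | y , c≼y , u~y = trans (sym (mono-Fc y c≼y)) (sym (adjacent-colour rb-u (rb-Fc y c≼y) u~y))

    subtree-colour : ∀ {u} → Acc (_⊏_ par) u →
      Desc par u ⊆ RedBlue col → Desc par u ⊆ (λ z → col z ≡ col u)
    subtree-colour (acc rec) rb z u≼z with desc-root-or-child par u≼z
    ... | inj₁ refl = refl
    ... | inj₂ (c , pc , c≼z) =
      trans (mono-Fc z c≼z) (child-colour pc (rb _ here) rb-Fc mono-Fc)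
      where
      rb-Fc : Desc par c ⊆ RedBlue col
      rb-Fc z' c≼z' = rb z' (desc-trans par (desc-child par pc) c≼z')
      mono-Fc : Desc par c ⊆ (λ z' → col z' ≡ col c)
      mono-Fc = subtree-colour (rec (_ , pc , here)) rb-Fc

    child-subtree-colour : IsForest par → ∀ {u p} → par u ≡ just p →
      RedBlue col p → Desc par u ⊆ RedBlue col → Desc par u ⊆ (λ z → col z ≡ col p)
    child-subtree-colour forest pu rb-p rb-Fu z u≼z =
      trans (mono-Fu z u≼z) (child-colour pu rb-p rb-Fu mono-Fu)
      where
      mono-Fu : Desc par _ ⊆ (λ z' → col z' ≡ col _)
      mono-Fu = subtree-colour (⊏-wellFounded par forest _) rb-Fu

    cont-colour : IsForest par → (k : ℕ) (P : Fin (suc k) → Fin n) (W : Fin n → Set) →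
      Cont par k P W ⊆ RedBlue col → ∀ {κ} →
      PathSet k P ⊆ (λ v → col v ≡ κ) → Cont par k P W ⊆ (λ v → col v ≡ κ)
    cont-colour forest k P W rb-Cont mono-P v (inj₁ v∈P) = mono-P v v∈P
    cont-colour forest k P W rb-Cont mono-P v (inj₂ (u , u≼v , appendix)) =
      let (p , pu , p∈P) = parent-on-path in
      trans (child-subtree-colour forest pu (rb-Cont p (inj₁ p∈P)) rb-Fu v u≼v) (mono-P p p∈P)
      where
      rb-Fu : Desc par u ⊆ RedBlue col
      rb-Fu z u≼z = rb-Cont z (inj₂ (u , u≼z , appendix))
      parent-on-path : ∃[ p ] (par u ≡ just p × PathSet k P p)
      parent-on-path =
        Sum.[ (λ (_ , pu , _) → _ , pu , (_ , refl)) , (λ (pu , _) → _ , pu , (_ , refl)) ] appendix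

lemma20 : ∀ {n} (H : Hypergraph n) (col : Fin n → Colour) (par : Parent n) →
    NoRedBlueEdge H col → IsElimForest H par → IsReduced H par →
    (k : ℕ) (P : Fin (suc k) → Fin n) → IsDirPath par k P →
    (∃[ c ] (par c ≡ just (finalV k P))) →
    (W : Fin n → Set) → (∀ w → W w → par w ≡ just (finalV k P)) → (∃[ w ] W w) →
    Cont par k P W ⊆ RedBlue col →
    Monochromatic col (PathSet k P) →
    Monochromatic col (Cont par k P W)
lemma20 H col par noRB (forest , _) reduced k P _ _ W _ _ rb-Cont =
  Sum.map (cont-colour H col noRB reduced forest k P W rb-Cont)
          (cont-colour H col noRB reduced forest k P W rb-Cont)
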